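{- Let the polynomials $\tilde F_n(z)$ be defined by $\tilde F_1(z)=1$ and $\tilde F_{n+1}(z)=z(z+1)\tilde F_n(z+1)-(z-1)z\tilde F_n(z)$ for $n\geq1$. Then for all $n\geq1$, \[ z\tilde F_n(z)=\sum_{j=0}^n(-1)^{n+j}LS(n,j)\,j!\,(z)^j, \] where $LS(n,j)$ are the Legendre–Stirling numbers of the second kind.
   Context: $(z)^0=1$ and $(z)^n=z(z+1)\cdots(z+n-1)$ for $n\geq1$ (rising factorial). Stirling type numbers of the second kind for a sequence $(a_n)_{n\geq1}$: $T(n+1,j)=T(n,j-1)+a_jT(n,j)$, $T(n,0)=\delta_{n,0}$, $T(n,j)=0$ for $n<j$. The Legendre–Stirling numbers of the second kind $LS(n,j)$ are these numbers for $a_n=n(n+1)$. -}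

module Defs where

open import Level using (Level)
open import Data.Nat using (ℕ; zero; suc) renaming (_+_ to _+ℕ_; _*_ to _*ℕ_)
open import Data.Nat using (_!)
open import Algebra.Bundles using (CommutativeRing)

LS : ℕ → ℕ → ℕ
LS zero    zero    = 1
LS zero    (suc j) = 0
LS (suc n) zero    = 0
LS (suc n) (suc j) = LS n j +ℕ (suc j *ℕ suc (suc j)) *ℕ LS n (suc j)

module _ {c ℓ : Level} (R : CommutativeRing c ℓ) where
  open CommutativeRing R hiding (zero)

  fromℕ : ℕ → Carrier
  fromℕ zero    = 0#
  fromℕ (suc n) = 1# + fromℕ n

  sgn : ℕ → Carrier
  sgn zero    = 1#
  sgn (suc k) = - sgn k

  rising : Carrier → ℕ → Carrier
  rising z zero    = 1#
  rising z (suc n) = z * rising (z + 1#) n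

  -- F̃ (suc m) is the paper's F̃_{m+1}, as a polynomial function on R:
  -- F̃_1(z) = 1, F̃_{n+1}(z) = z(z+1) F̃_n(z+1) - (z-1) z F̃_n(z).
  -- (F̃ 0 is an unused filler.)
  F̃ : ℕ → Carrier → Carrier
  F̃ zero          z = 0#
  F̃ (suc zero)    z = 1#
  F̃ (suc (suc n)) z =
    (z * (z + 1#)) * F̃ (suc n) (z + 1#) - ((z - 1#) * z) * F̃ (suc n) z

  sumTo : ℕ → (ℕ → Carrier) → Carrier
  sumTo zero    f = f zero
  sumTo (suc n) f = sumTo n f + f (suc n)

-- Put G n z = z F̃_n(z). The recurrence says G (n+1) = L (G n) for the operator
-- L f z = z (z f(z+1) − (z−1) f(z)), and L maps the rising factorial (z)^j to
-- (j+1) (z)^(j+1) − j(j+1) (z)^j. So if G n = Σ_j c(n,j) (z)^j, then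
-- c(n+1,j) = j c(n,j−1) − j(j+1) c(n,j), which is exactly the recurrence satisfied by
-- (−1)^(n+j) LS(n,j) j!; both sides agree for n = 1.

module Submission where

open import Defs
open import Level using (Level)
open import Data.Nat using (ℕ; zero; suc; _<_; s≤s; z≤n) renaming (_+_ to _+ℕ_; _*_ to _*ℕ_)
open import Data.Nat using (_!)
import Data.Nat.Properties as ℕ
open import Data.Nat.Tactic.RingSolver using (solve-∀)
open import Data.Integer as ℤ using (ℤ; +_; -[1+_]; _⊖_; _◃_; sign; ∣_∣; 0ℤ; 1ℤ)
import Data.Integer.Properties as ℤ
open import Data.Sign as Sign using (Sign)
open import Data.Maybe using (Maybe; just; nothing)
open import Relation.Nullary using (yes; no)
open import Relation.Binary.PropositionalEquality as ≡ using (_≡_)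
open import Algebra.Bundles using (CommutativeRing)
open import Algebra.Solver.Ring.AlmostCommutativeRing using (_-Raw-AlmostCommutative⟶_; fromCommutativeRing)

LS-above-diagonal : ∀ {n j} → n < j → LS n j ≡ 0
LS-above-diagonal {zero}  {suc j} _ = ≡.refl
LS-above-diagonal {suc n} {suc j} (s≤s n<j)
  rewrite LS-above-diagonal n<j | LS-above-diagonal (ℕ.m<n⇒m<1+n n<j) =
  ℕ.*-zeroʳ (suc j *ℕ suc (suc j))

LS-factorial-suc : ∀ n j →
  LS (suc n) (suc j) *ℕ suc j ! ≡
  suc j *ℕ (LS n j *ℕ j !) +ℕ (suc j *ℕ suc (suc j)) *ℕ (LS n (suc j) *ℕ suc j !)
LS-factorial-suc n j = expand (LS n j) (LS n (suc j)) (j !) j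
  where
  expand : ∀ a b f j →
    (a +ℕ (suc j *ℕ suc (suc j)) *ℕ b) *ℕ (f +ℕ j *ℕ f) ≡
    suc j *ℕ (a *ℕ f) +ℕ (suc j *ℕ suc (suc j)) *ℕ (b *ℕ (f +ℕ j *ℕ f))
  expand = solve-∀

module _ {c ℓ : Level} (R : CommutativeRing c ℓ) where
  open CommutativeRing R hiding (zero)
  open import Algebra.Properties.Ring ring
  open import Algebra.Properties.Semiring.Mult.TCOptimised semiring
  open import Algebra.Properties.CommutativeSemigroup +-commutativeSemigroup
    using () renaming (interchange to +-interchange)
  open import Algebra.Properties.CommutativeSemigroup *-commutativeSemigroup
    using () renaming (interchange to *-interchange)
  open import Relation.Binary.Reasoning.Setoid setoid

  fromℕ≈×1# : ∀ n → fromℕ R n ≈ n × 1#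
  fromℕ≈×1# zero    = refl
  fromℕ≈×1# (suc n) = trans (+-congˡ (fromℕ≈×1# n)) (sym (1+× n 1#))

  fromℕ-homo-+ : ∀ m n → fromℕ R (m +ℕ n) ≈ fromℕ R m + fromℕ R n
  fromℕ-homo-+ m n = begin
    fromℕ R (m +ℕ n)         ≈⟨ fromℕ≈×1# (m +ℕ n) ⟩
    (m +ℕ n) × 1#            ≈⟨ ×-homo-+ 1# m n ⟩
    m × 1# + n × 1#          ≈⟨ +-cong (fromℕ≈×1# m) (fromℕ≈×1# n) ⟨
    fromℕ R m + fromℕ R n    ∎

  fromℕ-homo-* : ∀ m n → fromℕ R (m *ℕ n) ≈ fromℕ R m * fromℕ R n
  fromℕ-homo-* m n = begin
    fromℕ R (m *ℕ n)         ≈⟨ fromℕ≈×1# (m *ℕ n) ⟩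
    (m *ℕ n) × 1#            ≈⟨ ×1-homo-* m n ⟩
    m × 1# * n × 1#          ≈⟨ *-cong (fromℕ≈×1# m) (fromℕ≈×1# n) ⟨
    fromℕ R m * fromℕ R n    ∎

  fromSign : Sign → Carrier
  fromSign Sign.+ = 1#
  fromSign Sign.- = - 1#

  fromSign-homo-* : ∀ s t → fromSign (s Sign.* t) ≈ fromSign s * fromSign t
  fromSign-homo-* Sign.+ t      = sym (*-identityˡ _)
  fromSign-homo-* Sign.- Sign.+ = sym (*-identityʳ _)
  fromSign-homo-* Sign.- Sign.- = sym (trans (-1*x≈-x (- 1#)) (-‿involutive 1#))

  -- The ring solver below uses integer coefficients, read in R through fromℤ.
  -- The optimised multiple _×_ makes 0ℤ and 1ℤ denote 0# and 1# on the nose,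
  -- so that solver constants are recognised by the final reflexivity check.
  fromℤ : ℤ → Carrier
  fromℤ (+ n)    = n × 1#
  fromℤ -[1+ n ] = - (suc n × 1#)

  fromℤ-◃ : ∀ s n → fromℤ (s ◃ n) ≈ fromSign s * n × 1#
  fromℤ-◃ s      zero    = sym (zeroʳ _)
  fromℤ-◃ Sign.+ (suc n) = sym (*-identityˡ _)
  fromℤ-◃ Sign.- (suc n) = sym (-1*x≈-x _)

  fromℤ-signAbs : ∀ i → fromℤ i ≈ fromSign (sign i) * ∣ i ∣ × 1#
  fromℤ-signAbs i = trans (reflexive (≡.cong fromℤ (≡.sym (ℤ.◃-inverse i)))) (fromℤ-◃ (sign i) ∣ i ∣)

  [x+y]-[x+z]≈y-z : ∀ x y z → (x + y) - (x + z) ≈ y - z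
  [x+y]-[x+z]≈y-z x y z = begin
    (x + y) + - (x + z)    ≈⟨ +-congˡ (-‿+-comm x z) ⟨
    (x + y) + (- x + - z)  ≈⟨ +-interchange x y (- x) (- z) ⟩
    (x - x) + (y - z)      ≈⟨ +-congʳ (-‿inverseʳ x) ⟩
    0# + (y - z)           ≈⟨ +-identityˡ (y - z) ⟩
    y - z                  ∎

  fromℤ-⊖ : ∀ m n → fromℤ (m ⊖ n) ≈ m × 1# - n × 1#
  fromℤ-⊖ m       zero    = begin
    fromℤ (m ⊖ 0)  ≡⟨ ≡.cong fromℤ (ℤ.⊖-≥ {m = m} {n = 0} z≤n) ⟩
    m × 1#         ≈⟨ +-identityʳ (m × 1#) ⟨
    m × 1# + 0#    ≈⟨ +-congˡ -0#≈0# ⟨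
    m × 1# - 0#    ∎
  fromℤ-⊖ zero    (suc n) = begin
    fromℤ (0 ⊖ suc n)     ≡⟨ ≡.cong fromℤ (ℤ.⊖-< {m = 0} {n = suc n} (s≤s z≤n)) ⟩
    - (suc n × 1#)        ≈⟨ +-identityˡ _ ⟨
    0# - suc n × 1#       ∎
  fromℤ-⊖ (suc m) (suc n) = begin
    fromℤ (suc m ⊖ suc n)               ≡⟨ ≡.cong fromℤ (ℤ.[1+m]⊖[1+n]≡m⊖n m n) ⟩
    fromℤ (m ⊖ n)                       ≈⟨ fromℤ-⊖ m n ⟩
    m × 1# - n × 1#                     ≈⟨ [x+y]-[x+z]≈y-z 1# (m × 1#) (n × 1#) ⟨
    (1# + m × 1#) - (1# + n × 1#)       ≈⟨ +-cong (1+× m 1#) (-‿cong (1+× n 1#)) ⟨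
    suc m × 1# - suc n × 1#             ∎

  fromℤ-homo-+ : ∀ i j → fromℤ (i ℤ.+ j) ≈ fromℤ i + fromℤ j
  fromℤ-homo-+ -[1+ m ] -[1+ n ] = begin
    - (suc (suc (m +ℕ n)) × 1#)          ≡⟨ ≡.cong (λ k → - (suc k × 1#)) (ℕ.+-suc m n) ⟨
    - ((suc m +ℕ suc n) × 1#)            ≈⟨ -‿cong (×-homo-+ 1# (suc m) (suc n)) ⟩
    - (suc m × 1# + suc n × 1#)          ≈⟨ -‿+-comm _ _ ⟨
    - (suc m × 1#) + - (suc n × 1#)      ∎
  fromℤ-homo-+ -[1+ m ] (+ n)    = trans (fromℤ-⊖ n (suc m)) (+-comm _ _)
  fromℤ-homo-+ (+ m)    -[1+ n ] = fromℤ-⊖ m (suc n)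
  fromℤ-homo-+ (+ m)    (+ n)    = ×-homo-+ 1# m n

  fromℤ-homo-* : ∀ i j → fromℤ (i ℤ.* j) ≈ fromℤ i * fromℤ j
  fromℤ-homo-* i j = begin
    fromℤ (i ℤ.* j)                                        ≈⟨ fromℤ-◃ (sign i Sign.* sign j) (∣ i ∣ *ℕ ∣ j ∣) ⟩
    fromSign (sign i Sign.* sign j) * (∣ i ∣ *ℕ ∣ j ∣) × 1# ≈⟨ *-cong (fromSign-homo-* (sign i) (sign j)) (×1-homo-* ∣ i ∣ ∣ j ∣) ⟩
    (fromSign (sign i) * fromSign (sign j)) * (∣ i ∣ × 1# * ∣ j ∣ × 1#)
                                                           ≈⟨ *-interchange _ _ _ _ ⟩
    (fromSign (sign i) * ∣ i ∣ × 1#) * (fromSign (sign j) * ∣ j ∣ × 1#)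
                                                           ≈⟨ *-cong (fromℤ-signAbs i) (fromℤ-signAbs j) ⟨
    fromℤ i * fromℤ j                                      ∎

  fromℤ-homo-‿ : ∀ i → fromℤ (ℤ.- i) ≈ - fromℤ i
  fromℤ-homo-‿ -[1+ n ]    = sym (-‿involutive _)
  fromℤ-homo-‿ (+ zero)    = sym -0#≈0#
  fromℤ-homo-‿ (+ (suc n)) = refl

  fromℤ-homomorphism : ℤ.+-*-rawRing -Raw-AlmostCommutative⟶ fromCommutativeRing R
  fromℤ-homomorphism = record
    { ⟦_⟧    = fromℤ
    ; +-homo = fromℤ-homo-+
    ; *-homo = fromℤ-homo-*
    ; -‿homo = fromℤ-homo-‿
    ; 0-homo = refl
    ; 1-homo = refl
    }

  fromℤ-≟ : ∀ i j → Maybe (fromℤ i ≈ fromℤ j)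
  fromℤ-≟ i j with i ℤ.≟ j
  ... | yes ≡.refl = just refl
  ... | no _       = nothing

  open import Algebra.Solver.Ring ℤ.+-*-rawRing (fromCommutativeRing R) fromℤ-homomorphism fromℤ-≟
    using (solve; _:=_; _:+_; _:*_; _:-_; :-_; con)

  rising-suc : ∀ j z → rising R z (suc j) ≈ rising R z j * (z + fromℕ R j)
  rising-suc zero    = solve 1 (λ z → z :* con 1ℤ := con 1ℤ :* (z :+ con 0ℤ)) refl
  rising-suc (suc j) z = begin
    z * rising R (z + 1#) (suc j)
      ≈⟨ *-congˡ (rising-suc j (z + 1#)) ⟩
    z * (r * ((z + 1#) + s))
      ≈⟨ solve 3 (λ z r s → z :* (r :* ((z :+ con 1ℤ) :+ s)) := (z :* r) :* (z :+ (con 1ℤ :+ s))) refl z r s ⟩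
    (z * r) * (z + (1# + s))
      ∎
    where
    r = rising R (z + 1#) j
    s = fromℕ R j

  sumTo-cong : ∀ n {f g : ℕ → Carrier} → (∀ j → f j ≈ g j) → sumTo R n f ≈ sumTo R n g
  sumTo-cong zero    f≈g = f≈g zero
  sumTo-cong (suc n) f≈g = +-cong (sumTo-cong n f≈g) (f≈g (suc n))

  sumTo-shift-minuend : ∀ n (f g : ℕ → Carrier) →
    sumTo R (suc n) (λ j → f j - g j) ≈ (f 0 + sumTo R n (λ j → f (suc j) - g j)) - g (suc n)
  sumTo-shift-minuend zero f g =
    solve 4 (λ f₀ g₀ f₁ g₁ → (f₀ :- g₀) :+ (f₁ :- g₁) := (f₀ :+ (f₁ :- g₀)) :- g₁) refl
      (f 0) (g 0) (f 1) (g 1)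
  sumTo-shift-minuend (suc n) f g = begin
    sumTo R (suc n) (λ j → f j - g j) + (f (2 +ℕ n) - g (2 +ℕ n))
      ≈⟨ +-congʳ (sumTo-shift-minuend n f g) ⟩
    ((f 0 + S) - g (suc n)) + (f (2 +ℕ n) - g (2 +ℕ n))
      ≈⟨ solve 5 (λ f₀ S g₁ f₂ g₂ → ((f₀ :+ S) :- g₁) :+ (f₂ :- g₂) := (f₀ :+ (S :+ (f₂ :- g₁))) :- g₂) refl
           (f 0) S (g (suc n)) (f (2 +ℕ n)) (g (2 +ℕ n)) ⟩
    (f 0 + sumTo R (suc n) (λ j → f (suc j) - g j)) - g (2 +ℕ n)
      ∎
    where S = sumTo R n (λ j → f (suc j) - g j)

  recurrenceStep : (Carrier → Carrier) → Carrier → Carrier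
  recurrenceStep f z = z * (z * f (z + 1#) - (z - 1#) * f z)

  zF̃-recurrenceStep : ∀ n z → z * F̃ R (suc (suc n)) z ≈ recurrenceStep (λ x → x * F̃ R (suc n) x) z
  zF̃-recurrenceStep n z =
    solve 3 (λ z F₁ F → z :* ((z :* (z :+ con 1ℤ)) :* F₁ :- ((z :- con 1ℤ) :* z) :* F)
                     := z :* (z :* ((z :+ con 1ℤ) :* F₁) :- (z :- con 1ℤ) :* (z :* F))) refl
      z (F̃ R (suc n) (z + 1#)) (F̃ R (suc n) z)

  recurrenceStep-cong : ∀ {f g} → (∀ x → f x ≈ g x) → ∀ z → recurrenceStep f z ≈ recurrenceStep g z
  recurrenceStep-cong f≈g z = *-congˡ (+-cong (*-congˡ (f≈g (z + 1#))) (-‿cong (*-congˡ (f≈g z))))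

  recurrenceStep-scale : ∀ a g z → recurrenceStep (λ x → a * g x) z ≈ a * recurrenceStep g z
  recurrenceStep-scale a g z =
    solve 4 (λ z a g₁ g → z :* (z :* (a :* g₁) :- (z :- con 1ℤ) :* (a :* g))
                       := a :* (z :* (z :* g₁ :- (z :- con 1ℤ) :* g))) refl
      z a (g (z + 1#)) (g z)

  recurrenceStep-+-scale : ∀ f a g z →
    recurrenceStep (λ x → f x + a * g x) z ≈ recurrenceStep f z + a * recurrenceStep g z
  recurrenceStep-+-scale f a g z =
    solve 6 (λ z f₁ f a g₁ g → z :* (z :* (f₁ :+ a :* g₁) :- (z :- con 1ℤ) :* (f :+ a :* g))
                            := z :* (z :* f₁ :- (z :- con 1ℤ) :* f) :+ a :* (z :* (z :* g₁ :- (z :- con 1ℤ) :* g))) refl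
      z (f (z + 1#)) (f z) a (g (z + 1#)) (g z)

  recurrenceStep-sumTo : ∀ n (a : ℕ → Carrier) (u : ℕ → Carrier → Carrier) z →
    recurrenceStep (λ x → sumTo R n (λ j → a j * u j x)) z ≈ sumTo R n (λ j → a j * recurrenceStep (u j) z)
  recurrenceStep-sumTo zero    a u z = recurrenceStep-scale (a 0) (u 0) z
  recurrenceStep-sumTo (suc n) a u z =
    trans (recurrenceStep-+-scale (λ x → sumTo R n (λ j → a j * u j x)) (a (suc n)) (u (suc n)) z)
          (+-congʳ (recurrenceStep-sumTo n a u z))

  recurrenceStep-rising : ∀ j z →
    recurrenceStep (λ x → rising R x j) z ≈ fromℕ R (suc j) * rising R z (suc j) - fromℕ R (j *ℕ suc j) * rising R z j
  recurrenceStep-rising j z = begin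
    z * (rising R z (suc j) - (z - 1#) * r)
      ≈⟨ *-congˡ (+-congʳ (rising-suc j z)) ⟩
    z * (r * (z + s) - (z - 1#) * r)
      ≈⟨ solve 3 (λ z r s → z :* (r :* (z :+ s) :- (z :- con 1ℤ) :* r)
                         := (con 1ℤ :+ s) :* (r :* (z :+ s)) :- (s :* (con 1ℤ :+ s)) :* r) refl z r s ⟩
    (1# + s) * (r * (z + s)) - (s * (1# + s)) * r
      ≈⟨ +-cong (*-congˡ (rising-suc j z)) (-‿cong (*-congʳ (fromℕ-homo-* j (suc j)))) ⟨
    fromℕ R (suc j) * rising R z (suc j) - fromℕ R (j *ℕ suc j) * r
      ∎
    where
    r = rising R z j
    s = fromℕ R j

  sgn-+-suc : ∀ m k → sgn R (m +ℕ suc k) ≈ - sgn R (m +ℕ k)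
  sgn-+-suc m k = reflexive (≡.cong (sgn R) (ℕ.+-suc m k))

  coefficient : ℕ → ℕ → Carrier
  coefficient n j = sgn R (n +ℕ j) * fromℕ R (LS n j *ℕ j !)

  coefficient-above-diagonal : ∀ {n j} → n < j → coefficient n j ≈ 0#
  coefficient-above-diagonal {n} {j} n<j = begin
    sgn R (n +ℕ j) * fromℕ R (LS n j *ℕ j !)  ≡⟨ ≡.cong (λ k → sgn R (n +ℕ j) * fromℕ R (k *ℕ j !)) (LS-above-diagonal n<j) ⟩
    sgn R (n +ℕ j) * 0#                       ≈⟨ zeroʳ _ ⟩
    0#                                        ∎

  coefficient-suc-suc : ∀ n j →
    coefficient (suc n) (suc j) ≈
    fromℕ R (suc j) * coefficient n j - fromℕ R (suc j *ℕ suc (suc j)) * coefficient n (suc j)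
  coefficient-suc-suc n j = begin
    sgn R (suc n +ℕ suc j) * fromℕ R (LS (suc n) (suc j) *ℕ suc j !)
      ≡⟨ ≡.cong (λ k → sgn R (suc n +ℕ suc j) * fromℕ R k) (LS-factorial-suc n j) ⟩
    - sgn R (n +ℕ suc j) * fromℕ R (suc j *ℕ P +ℕ w *ℕ Q)
      ≈⟨ *-cong (-‿cong (sgn-+-suc n j)) expand ⟩
    - (- σ) * (fromℕ R (suc j) * fromℕ R P + fromℕ R w * fromℕ R Q)
      ≈⟨ solve 5 (λ σ t p w q → :- (:- σ) :* (t :* p :+ w :* q) := t :* (σ :* p) :- w :* (:- σ :* q)) refl
           σ (fromℕ R (suc j)) (fromℕ R P) (fromℕ R w) (fromℕ R Q) ⟩
    fromℕ R (suc j) * (σ * fromℕ R P) - fromℕ R w * (- σ * fromℕ R Q)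
      ≈⟨ +-congˡ (-‿cong (*-congˡ (*-congʳ (sgn-+-suc n j)))) ⟨
    fromℕ R (suc j) * coefficient n j - fromℕ R w * coefficient n (suc j)
      ∎
    where
    σ = sgn R (n +ℕ j)
    P = LS n j *ℕ j !
    Q = LS n (suc j) *ℕ suc j !
    w = suc j *ℕ suc (suc j)
    expand : fromℕ R (suc j *ℕ P +ℕ w *ℕ Q) ≈ fromℕ R (suc j) * fromℕ R P + fromℕ R w * fromℕ R Q
    expand = trans (fromℕ-homo-+ (suc j *ℕ P) (w *ℕ Q)) (+-cong (fromℕ-homo-* (suc j) P) (fromℕ-homo-* w Q))

  expansion : ℕ → Carrier → Carrier
  expansion n z = sumTo R n (λ j → coefficient n j * rising R z j)

  recurrenceStep-expansion : ∀ n z → recurrenceStep (expansion n) z ≈ expansion (suc n) z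
  recurrenceStep-expansion n z = begin
    recurrenceStep (λ x → sumTo R n (λ j → a j * rising R x j)) z
      ≈⟨ recurrenceStep-sumTo n a (λ j x → rising R x j) z ⟩
    sumTo R n (λ j → a j * recurrenceStep (λ x → rising R x j) z)
      ≈⟨ sumTo-cong n (λ j → trans (*-congˡ (recurrenceStep-rising j z)) (x[y-z]≈xy-xz _ _ _)) ⟩
    sumTo R n (λ j → X (suc j) - Y j)
      ≈⟨ solve 1 (λ S → S := (con 0ℤ :+ S) :- con 0ℤ) refl _ ⟩
    (0# + sumTo R n (λ j → X (suc j) - Y j)) - 0#
      ≈⟨ +-congˡ (-‿cong Y-top) ⟨
    (X 0 + sumTo R n (λ j → X (suc j) - Y j)) - Y (suc n)
      ≈⟨ sumTo-shift-minuend n X Y ⟨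
    sumTo R (suc n) (λ j → X j - Y j)
      ≈⟨ sumTo-cong (suc n) coefficient-times-rising ⟨
    expansion (suc n) z
      ∎
    where
    a = coefficient n
    X : ℕ → Carrier
    X zero    = 0#
    X (suc j) = a j * (fromℕ R (suc j) * rising R z (suc j))
    Y : ℕ → Carrier
    Y j = a j * (fromℕ R (j *ℕ suc j) * rising R z j)
    Y-top : Y (suc n) ≈ 0#
    Y-top = trans (*-congʳ (coefficient-above-diagonal (ℕ.n<1+n n))) (zeroˡ _)
    coefficient-times-rising : ∀ j → coefficient (suc n) j * rising R z j ≈ X j - Y j
    coefficient-times-rising zero =
      solve 2 (λ σ α → (σ :* con 0ℤ) :* con 1ℤ := con 0ℤ :- α :* (con 0ℤ :* con 1ℤ)) refl
        (sgn R (suc n +ℕ 0)) (a 0)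
    coefficient-times-rising (suc j) = begin
      coefficient (suc n) (suc j) * r
        ≈⟨ *-congʳ (coefficient-suc-suc n j) ⟩
      (t * a j - w * a (suc j)) * r
        ≈⟨ solve 5 (λ t α w β r → (t :* α :- w :* β) :* r := α :* (t :* r) :- β :* (w :* r)) refl
             t (a j) w (a (suc j)) r ⟩
      X (suc j) - Y (suc j)
        ∎
      where
      r = rising R z (suc j)
      t = fromℕ R (suc j)
      w = fromℕ R (suc j *ℕ suc (suc j))

  zF̃≈expansion : ∀ n z → z * F̃ R (suc n) z ≈ expansion (suc n) z
  zF̃≈expansion zero z =
    solve 1 (λ z → z :* con 1ℤ
                := (:- con 1ℤ :* con 0ℤ) :* con 1ℤ :+ (:- (:- con 1ℤ) :* (con 1ℤ :+ con 0ℤ)) :* (z :* con 1ℤ)) refl z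
  zF̃≈expansion (suc n) z = begin
    z * F̃ R (suc (suc n)) z                   ≈⟨ zF̃-recurrenceStep n z ⟩
    recurrenceStep (λ x → x * F̃ R (suc n) x) z ≈⟨ recurrenceStep-cong (λ x → zF̃≈expansion n x) z ⟩
    recurrenceStep (expansion (suc n)) z        ≈⟨ recurrenceStep-expansion (suc n) z ⟩
    expansion (suc (suc n)) z                   ∎

proposition4 : ∀ {c ℓ : Level} (R : CommutativeRing c ℓ) (n : ℕ) (z : CommutativeRing.Carrier R) →
    CommutativeRing._≈_ R
      (CommutativeRing._*_ R z (F̃ R (suc n) z))
      (sumTo R (suc n) (λ j → CommutativeRing._*_ R (CommutativeRing._*_ R (sgn R (suc n +ℕ j)) (fromℕ R (LS (suc n) j *ℕ (j !)))) (rising R z j)))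
proposition4 = zF̃≈expansion
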